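{- For every integer $k\ge 3$ and every $n\ge 0$, $\dfrac{r_k(n)}{k^n}\le\left(1-\dfrac{k(k-1)(k-2)}{k^4}\right)^{\lfloor n/4\rfloor}$.
   Context: A palindrome is a word equal to its reversal (the empty word is a palindrome). A finite word $w$ is rich if it has exactly $|w|+1$ distinct palindromic factors (counting the empty word). $r_k(n)$ denotes the number of rich words of length $n$ over a fixed alphabet with $k$ letters. -}

module Defs where

open import Data.Nat using (ℕ; zero; suc)
open import Data.Fin using (Fin)
import Data.Fin.Properties as FinP
open import Data.List using (List; []; _∷_; length; map; concatMap; inits; tails; filter; deduplicate; reverse; allFin)
import Data.List.Properties as ListP
open import Relation.Binary.PropositionalEquality using (_≡_)
open import Relation.Nullary using (Dec)

Word : ℕ → Set
Word k = List (Fin k)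

_≟w_ : ∀ {k} (u v : Word k) → Dec (u ≡ v)
_≟w_ = ListP.≡-dec FinP._≟_

IsPalindrome : ∀ {k} → Word k → Set
IsPalindrome w = w ≡ reverse w

isPalindrome? : ∀ {k} (w : Word k) → Dec (IsPalindrome w)
isPalindrome? w = w ≟w reverse w

factors : ∀ {k} → Word k → List (Word k)
factors w = concatMap inits (tails w)

distinctPalFactors : ∀ {k} → Word k → List (Word k)
distinctPalFactors w = deduplicate _≟w_ (filter isPalindrome? (factors w))

Rich : ∀ {k} → Word k → Set
Rich w = length (distinctPalFactors w) ≡ suc (length w)

rich? : ∀ {k} (w : Word k) → Dec (Rich w)
rich? w = Data.Nat._≟_ (length (distinctPalFactors w)) (suc (length w))
  where import Data.Nat

allWords : (k n : ℕ) → List (Word k)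
allWords k zero = [] ∷ []
allWords k (suc n) = concatMap (λ a → map (a ∷_) (allWords k n)) (allFin k)

r : ℕ → ℕ → ℕ
r k n = length (filter rich? (allWords k n))

module Submission where

-- Prepending a letter to a word creates at most one new palindromic factor, its longest palindromic
-- prefix: a shorter palindromic prefix of a palindrome is also a suffix of it, hence occurs further
-- right. So |Pal(u w v)| ≤ |u| + |Pal(w)| + |v| (the right end by reversal), a word w has at most
-- |w| + 1 palindromic factors, and every factor of a rich word is rich. The word abca with a, b, c
-- distinct has only the palindromic factors ε, a, b, c, so no rich word contains it. Cutting a word
-- of length n into ⌊n/4⌋ aligned blocks of length 4 and a remainder, no block of a rich word is one
-- of the k(k-1)(k-2) words abca, so r_k(n) ≤ (k⁴ - k(k-1)(k-2))^⌊n/4⌋ · k^(n mod 4).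

open import Defs
open import Data.Nat using (ℕ; zero; suc; _+_; _*_; _∸_; _^_; _≤_; _<_; _/_; z≤n; s≤s; z<s)
open import Data.Nat.Properties hiding (_≟_)
open import Data.Fin using (Fin)
import Data.Fin as Fin
open import Data.Fin.Properties using (_≟_)
open import Data.Bool using (Bool; true; false; _∧_; not)
open import Data.Bool.Properties using (∧-identityʳ; not-involutive)
open import Data.List using (List; []; _∷_; _++_; length; map; filter; concatMap; tabulate; take; drop; inits; reverse)
open import Data.List.Properties
  using (∷-injectiveˡ; ∷-injectiveʳ; ++-assoc; ++-identityʳ; length-++; length-++-sucʳ; length-reverse; reverse-++; reverse-involutive)
open import Data.List.Membership.Propositional using (_∈_; _∉_)
open import Data.List.Membership.Propositional.Properties using (∈-∃++; ∈-++⁻; ∈-++⁺ˡ; ∈-++⁺ʳ; ∈-map⁺; ∈-map⁻; ∈-filter⁺; ∈-filter⁻; ∈-deduplicate⁺; ∈-deduplicate⁻)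
open import Data.List.Relation.Unary.Any using (here; there)
import Data.List.Relation.Unary.All as All
open import Data.List.Relation.Unary.AllPairs using (_∷_)
open import Data.List.Relation.Unary.Unique.Propositional using (Unique)
open import Data.List.Relation.Unary.Unique.DecPropositional.Properties using (deduplicate-!)
import Data.List.Membership.DecPropositional as DecMembership
open import Data.Product using (∃-syntax; ∃₂; _×_; _,_)
open import Data.Sum using (_⊎_; inj₁; inj₂; [_,_]′)
open import Function using (id)
open import Data.Empty using (⊥-elim)
open import Relation.Nullary using (¬_; yes; no; does)
open import Relation.Binary using (tri<; tri≈; tri>)
open import Relation.Unary using (Decidable)
open import Algebra.Properties.Semiring.Sum +-*-semiring using (sum-syntax; sum-cong-≗; ∑-distrib-+; *-distribʳ-sum)
open import Algebra.Properties.CommutativeSemigroup +-commutativeSemigroup using () renaming (interchange to +-interchange)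
open import Algebra.Properties.CommutativeSemigroup *-commutativeSemigroup using () renaming (interchange to *-interchange)
open import Data.Nat.DivMod using (m/n≡1+[m∸n]/n)
open import Relation.Binary.PropositionalEquality

module _ {A : Set} where

  Prefix : List A → List A → Set
  Prefix z w = ∃[ y ] z ++ y ≡ w

  Factor : List A → List A → Set
  Factor z w = ∃₂ λ x y → x ++ z ++ y ≡ w

  ∈-remove : ∀ {z x : A} ys₁ ys₂ → z ∈ ys₁ ++ x ∷ ys₂ → z ≢ x → z ∈ ys₁ ++ ys₂
  ∈-remove []        ys₂ (here z≡x)  z≢x = ⊥-elim (z≢x z≡x)
  ∈-remove []        ys₂ (there z∈)  z≢x = z∈
  ∈-remove (y ∷ ys₁) ys₂ (here z≡y)  z≢x = here z≡y
  ∈-remove (y ∷ ys₁) ys₂ (there z∈)  z≢x = there (∈-remove ys₁ ys₂ z∈ z≢x)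

  Unique-⊆⇒length≤ : ∀ {xs ys : List A} → Unique xs → (∀ {z} → z ∈ xs → z ∈ ys) → length xs ≤ length ys
  Unique-⊆⇒length≤ {[]}     _               _   = z≤n
  Unique-⊆⇒length≤ {x ∷ xs} (x∉xs ∷ uniq) xs⊆ys with ∈-∃++ (xs⊆ys (here refl))
  ... | ys₁ , ys₂ , refl = begin
    suc (length xs)            ≤⟨ s≤s (Unique-⊆⇒length≤ uniq xs⊆ys₁++ys₂) ⟩
    suc (length (ys₁ ++ ys₂))  ≡⟨ length-++-sucʳ ys₁ x ys₂ ⟨
    length (ys₁ ++ x ∷ ys₂)    ∎
    where
    open ≤-Reasoning
    xs⊆ys₁++ys₂ : ∀ {z} → z ∈ xs → z ∈ ys₁ ++ ys₂
    xs⊆ys₁++ys₂ z∈xs = ∈-remove ys₁ ys₂ (xs⊆ys (there z∈xs)) (λ z≡x → All.lookup x∉xs z∈xs (sym z≡x))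

  Unique-⊆⇒length≤suc : ∀ {P : A → Set} {xs ys : List A} → Unique xs →
    (∀ {z} → z ∈ xs → z ∈ ys ⊎ P z) → (∀ {z z′} → P z → P z′ → z ≡ z′) → length xs ≤ suc (length ys)
  Unique-⊆⇒length≤suc {xs = []} _ _ _ = z≤n
  Unique-⊆⇒length≤suc {P} {x ∷ xs} {ys} (x∉xs ∷ uniq) xs⊆ys⊎P P-unique with xs⊆ys⊎P (here refl)
  ... | inj₂ Px = s≤s (Unique-⊆⇒length≤ uniq xs⊆ys)
    where
    xs⊆ys : ∀ {z} → z ∈ xs → z ∈ ys
    xs⊆ys {z} z∈xs with xs⊆ys⊎P (there z∈xs)
    ... | inj₁ z∈ys = z∈ys
    ... | inj₂ Pz   = ⊥-elim (All.lookup x∉xs z∈xs (P-unique Px Pz))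
  ... | inj₁ x∈ys with ∈-∃++ x∈ys
  ... | ys₁ , ys₂ , refl = begin
    length (x ∷ xs)                 ≤⟨ s≤s (Unique-⊆⇒length≤suc uniq xs⊆ys₁++ys₂⊎P P-unique) ⟩
    suc (suc (length (ys₁ ++ ys₂)))  ≡⟨ cong suc (length-++-sucʳ ys₁ x ys₂) ⟨
    suc (length (ys₁ ++ x ∷ ys₂))    ∎
    where
    open ≤-Reasoning
    xs⊆ys₁++ys₂⊎P : ∀ {z} → z ∈ xs → z ∈ ys₁ ++ ys₂ ⊎ P z
    xs⊆ys₁++ys₂⊎P z∈xs with xs⊆ys⊎P (there z∈xs)
    ... | inj₁ z∈ys = inj₁ (∈-remove ys₁ ys₂ z∈ys (λ z≡x → All.lookup x∉xs z∈xs (sym z≡x)))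
    ... | inj₂ Pz   = inj₂ Pz

  ∈-inits⁻ : ∀ {z} w → z ∈ inits w → Prefix z w
  ∈-inits⁻ w       (here refl) = w , refl
  ∈-inits⁻ (a ∷ w) (there z∈)  with ∈-map⁻ (a ∷_) z∈
  ... | z′ , z′∈ , refl with ∈-inits⁻ w z′∈
  ... | y , refl = y , refl

  ∈-inits⁺ : ∀ {z w} → Prefix z w → z ∈ inits w
  ∈-inits⁺ {[]}    _          = here refl
  ∈-inits⁺ {a ∷ z} (y , refl) = there (∈-map⁺ (a ∷_) (∈-inits⁺ (y , refl)))

  prefix-≤ : ∀ {z₁ z₂ w} → Prefix z₁ w → Prefix z₂ w → length z₁ ≤ length z₂ → Prefix z₁ z₂
  prefix-≤ {[]}              _            _            _       = _ , refl
  prefix-≤ {a ∷ z₁} {b ∷ z₂} (y₁ , refl) (y₂ , eq) (s≤s l) with refl ← ∷-injectiveˡ eq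
    with t , refl ← prefix-≤ {z₁} {z₂} (y₁ , refl) (y₂ , ∷-injectiveʳ eq) l = t , refl

  prefix-≡ : ∀ {z₁ z₂ w} → Prefix z₁ w → Prefix z₂ w → length z₁ ≡ length z₂ → z₁ ≡ z₂
  prefix-≡ {z₁} p₁ p₂ eq with prefix-≤ p₁ p₂ (≤-reflexive eq)
  ... | [] , refl = sym (++-identityʳ z₁)
  ... | a ∷ t , refl = ⊥-elim (<-irrefl eq (begin-strict
    length z₁              <⟨ m<m+n (length z₁) z<s ⟩
    length z₁ + suc (length t) ≡⟨ length-++ z₁ ⟨
    length (z₁ ++ a ∷ t)  ∎))
    where open ≤-Reasoning

  factor-∷ : ∀ {a z w} → Factor z w → Factor z (a ∷ w)
  factor-∷ {a} (x , y , refl) = a ∷ x , y , refl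

  factor-∷⁻ : ∀ {a z w} → Factor z (a ∷ w) → Prefix z (a ∷ w) ⊎ Factor z w
  factor-∷⁻ ([]    , y , eq)   = inj₁ (y , eq)
  factor-∷⁻ (_ ∷ x , y , refl) = inj₂ (x , y , refl)

  prefix-shift : ∀ {a : A} {z w} s → Prefix (s ++ z) (a ∷ w) → s ≢ [] → Factor z w
  prefix-shift []      _          s≢[] = ⊥-elim (s≢[] refl)
  prefix-shift {z = z} (c ∷ s) (y , refl) _ = s , y , sym (++-assoc s z y)

  reverse-extension≢[] : ∀ (z t : List A) → length z < length (z ++ t) → reverse t ≢ []
  reverse-extension≢[] z []      |z|<|z| _ = <-irrefl (cong length (sym (++-identityʳ z))) |z|<|z|
  reverse-extension≢[] z (c ∷ t) _   eq = 0≢1+n (trans (sym (cong length eq)) (length-reverse (c ∷ t)))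

module _ {k : ℕ} where

  open DecMembership (_≟w_ {k}) using (_∈?_)

  private variable
    a b c d : Fin k
    u v w z z₁ z₂ : Word k

  palFactorCount : Word k → ℕ
  palFactorCount w = length (distinctPalFactors w)

  ∈-factors⁻ : ∀ w → z ∈ factors w → Factor z w
  ∈-factors⁻ []      (here refl) = [] , [] , refl
  ∈-factors⁻ (a ∷ w) z∈ with ∈-++⁻ (inits (a ∷ w)) z∈
  ... | inj₁ z∈inits   = [] , ∈-inits⁻ (a ∷ w) z∈inits
  ... | inj₂ z∈factors = factor-∷ (∈-factors⁻ w z∈factors)

  ∈-factors⁺ : Factor z w → z ∈ factors w
  ∈-factors⁺ ([]    , y , refl) = ∈-++⁺ˡ (∈-inits⁺ (y , refl))
  ∈-factors⁺ (a ∷ x , y , refl) = ∈-++⁺ʳ (inits (a ∷ x ++ _ ++ y)) (∈-factors⁺ (x , y , refl))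

  ∈-distinctPalFactors⁻ : ∀ w → z ∈ distinctPalFactors w → IsPalindrome z × Factor z w
  ∈-distinctPalFactors⁻ w z∈ with ∈-filter⁻ isPalindrome? {xs = factors w} (∈-deduplicate⁻ _≟w_ _ z∈)
  ... | z∈factors , pal = pal , ∈-factors⁻ w z∈factors

  ∈-distinctPalFactors⁺ : IsPalindrome z → Factor z w → z ∈ distinctPalFactors w
  ∈-distinctPalFactors⁺ pal fac = ∈-deduplicate⁺ _≟w_ (∈-filter⁺ isPalindrome? (∈-factors⁺ fac) pal)

  palFactorCount-mono : (∀ {z} → IsPalindrome z → Factor z u → Factor z v) →
                        palFactorCount u ≤ palFactorCount v
  palFactorCount-mono {u = u} u⊑v = Unique-⊆⇒length≤ (deduplicate-! _≟w_ (filter isPalindrome? (factors u))) λ z∈ →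
    let pal , fac = ∈-distinctPalFactors⁻ u z∈ in ∈-distinctPalFactors⁺ pal (u⊑v pal fac)

  factor-reverse : IsPalindrome z → Factor z w → Factor z (reverse w)
  factor-reverse {z = z} pal (x , y , refl) = reverse y , reverse x , (begin
    reverse y ++ z ++ reverse x          ≡⟨ cong (λ t → reverse y ++ t ++ reverse x) pal ⟩
    reverse y ++ reverse z ++ reverse x  ≡⟨ cong (reverse y ++_) (reverse-++ x z) ⟨
    reverse y ++ reverse (x ++ z)        ≡⟨ reverse-++ (x ++ z) y ⟨
    reverse ((x ++ z) ++ y)              ≡⟨ cong reverse (++-assoc x z y) ⟩
    reverse (x ++ z ++ y)                ∎)
    where open ≡-Reasoning

  palFactorCount-reverse : ∀ w → palFactorCount (reverse w) ≡ palFactorCount w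
  palFactorCount-reverse w = ≤-antisym
    (palFactorCount-mono {u = reverse w} λ pal fac → subst (Factor _) (reverse-involutive w) (factor-reverse pal fac))
    (palFactorCount-mono {u = w} factor-reverse)

  palindrome-extension : ∀ {t} → IsPalindrome z → IsPalindrome (z ++ t) → z ++ t ≡ reverse t ++ z
  palindrome-extension {z = z} {t} pal pal′ = trans pal′ (trans (reverse-++ z t) (cong (reverse t ++_) (sym pal)))

  -- A shorter palindromic prefix z₁ of the palindrome z₂ = z₁ t is also its suffix: z₂ = (reverse t) z₁.
  palindromicPrefix-recurs : IsPalindrome z₁ → IsPalindrome z₂ →
    Prefix z₁ (a ∷ w) → Prefix z₂ (a ∷ w) → length z₁ < length z₂ → Factor z₁ w
  palindromicPrefix-recurs {z₁ = z₁} pal₁ pal₂ pre₁ pre₂ |z₁|<|z₂|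
    with t , refl ← prefix-≤ pre₁ pre₂ (<⇒≤ |z₁|<|z₂|)
    = prefix-shift (reverse t) (subst (λ s → Prefix s _) (palindrome-extension pal₁ pal₂) pre₂)
                   (reverse-extension≢[] z₁ t |z₁|<|z₂|)

  palFactorCount-∷ : ∀ a w → palFactorCount (a ∷ w) ≤ suc (palFactorCount w)
  palFactorCount-∷ a w = Unique-⊆⇒length≤suc {P = NewPalPrefix}
    (deduplicate-! _≟w_ (filter isPalindrome? (factors (a ∷ w)))) old⊎new new-unique
    where
    NewPalPrefix : Word k → Set
    NewPalPrefix z = IsPalindrome z × Prefix z (a ∷ w) × z ∉ distinctPalFactors w

    old⊎new : z ∈ distinctPalFactors (a ∷ w) → z ∈ distinctPalFactors w ⊎ NewPalPrefix z
    old⊎new {z} z∈ with ∈-distinctPalFactors⁻ (a ∷ w) z∈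
    ... | pal , fac with factor-∷⁻ fac | z ∈? distinctPalFactors w
    ... | inj₂ fac′ | _       = inj₁ (∈-distinctPalFactors⁺ pal fac′)
    ... | inj₁ _    | yes z∈′ = inj₁ z∈′
    ... | inj₁ pre  | no z∉′  = inj₂ (pal , pre , z∉′)

    new-unique : NewPalPrefix z₁ → NewPalPrefix z₂ → z₁ ≡ z₂
    new-unique {z₁} {z₂} (pal₁ , pre₁ , z₁∉) (pal₂ , pre₂ , z₂∉) with <-cmp (length z₁) (length z₂)
    ... | tri< lt _ _ = ⊥-elim (z₁∉ (∈-distinctPalFactors⁺ pal₁ (palindromicPrefix-recurs pal₁ pal₂ pre₁ pre₂ lt)))
    ... | tri≈ _ eq _ = prefix-≡ pre₁ pre₂ eq
    ... | tri> _ _ gt = ⊥-elim (z₂∉ (∈-distinctPalFactors⁺ pal₂ (palindromicPrefix-recurs pal₂ pal₁ pre₂ pre₁ gt)))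

  palFactorCount-∷-recurring : (∀ {z} → IsPalindrome z → Prefix z (a ∷ w) → Factor z w) →
                               palFactorCount (a ∷ w) ≤ palFactorCount w
  palFactorCount-∷-recurring recurs = palFactorCount-mono λ pal fac → [ recurs pal , id ]′ (factor-∷⁻ fac)

  palFactorCount≤ : ∀ w → palFactorCount w ≤ suc (length w)
  palFactorCount≤ []      = ≤-refl
  palFactorCount≤ (a ∷ w) = ≤-trans (palFactorCount-∷ a w) (s≤s (palFactorCount≤ w))

  palFactorCount-++ˡ : ∀ u w → palFactorCount (u ++ w) ≤ length u + palFactorCount w
  palFactorCount-++ˡ []      w = ≤-refl
  palFactorCount-++ˡ (a ∷ u) w = ≤-trans (palFactorCount-∷ a (u ++ w)) (s≤s (palFactorCount-++ˡ u w))

  palFactorCount-++ʳ : ∀ u w → palFactorCount (u ++ w) ≤ palFactorCount u + length w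
  palFactorCount-++ʳ u w = begin
    palFactorCount (u ++ w)                        ≡⟨ palFactorCount-reverse (u ++ w) ⟨
    palFactorCount (reverse (u ++ w))              ≡⟨ cong palFactorCount (reverse-++ u w) ⟩
    palFactorCount (reverse w ++ reverse u)        ≤⟨ palFactorCount-++ˡ (reverse w) (reverse u) ⟩
    length (reverse w) + palFactorCount (reverse u) ≡⟨ cong₂ _+_ (length-reverse w) (palFactorCount-reverse u) ⟩
    length w + palFactorCount u                     ≡⟨ +-comm (length w) (palFactorCount u) ⟩
    palFactorCount u + length w                     ∎
    where open ≤-Reasoning

  rich-prefix : ∀ u v → Rich (u ++ v) → Rich u
  rich-prefix u v rich = ≤-antisym (palFactorCount≤ u) (+-cancelʳ-≤ (length v) _ _ (begin
    suc (length u) + length v  ≡⟨ cong suc (length-++ u) ⟨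
    suc (length (u ++ v))      ≡⟨ rich ⟨
    palFactorCount (u ++ v)    ≤⟨ palFactorCount-++ʳ u v ⟩
    palFactorCount u + length v ∎))
    where open ≤-Reasoning

  rich-suffix : ∀ u v → Rich (u ++ v) → Rich v
  rich-suffix u v rich = ≤-antisym (palFactorCount≤ v) (+-cancelˡ-≤ (length u) _ _ (begin
    length u + suc (length v)  ≡⟨ +-suc (length u) (length v) ⟩
    suc (length u + length v)  ≡⟨ cong suc (length-++ u) ⟨
    suc (length (u ++ v))      ≡⟨ rich ⟨
    palFactorCount (u ++ v)    ≤⟨ palFactorCount-++ˡ u v ⟩
    length u + palFactorCount v ∎))
    where open ≤-Reasoning

  abca-palindromicPrefix-recurs : a ≢ b → b ≢ c → a ≢ c →
    IsPalindrome z → Prefix z (a ∷ b ∷ c ∷ a ∷ []) → Factor z (b ∷ c ∷ a ∷ [])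
  abca-palindromicPrefix-recurs {z = []}                    _   _   _   _   _          = [] , _ , refl
  abca-palindromicPrefix-recurs {z = _ ∷ []}                _   _   _   _   (_ , refl) = _ ∷ _ ∷ [] , [] , refl
  abca-palindromicPrefix-recurs {z = _ ∷ _ ∷ []}            a≢b _   _   pal (_ , refl) = ⊥-elim (a≢b (∷-injectiveˡ pal))
  abca-palindromicPrefix-recurs {z = _ ∷ _ ∷ _ ∷ []}        _   _   a≢c pal (_ , refl) = ⊥-elim (a≢c (∷-injectiveˡ pal))
  abca-palindromicPrefix-recurs {z = _ ∷ _ ∷ _ ∷ _ ∷ []}    _   b≢c _   pal (_ , refl) = ⊥-elim (b≢c (∷-injectiveˡ (∷-injectiveʳ pal)))
  abca-palindromicPrefix-recurs {z = _ ∷ _ ∷ _ ∷ _ ∷ _ ∷ _} _   _   _   _   (_ , ())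

  abca-¬rich : a ≢ b → b ≢ c → a ≢ c → ¬ Rich (a ∷ b ∷ c ∷ a ∷ [])
  abca-¬rich {a} {b} {c} a≢b b≢c a≢c rich = <-irrefl refl (begin-strict
    4                                      <⟨ ≤-refl ⟩
    5                                      ≡⟨ rich ⟨
    palFactorCount (a ∷ b ∷ c ∷ a ∷ [])    ≤⟨ palFactorCount-∷-recurring (abca-palindromicPrefix-recurs a≢b b≢c a≢c) ⟩
    palFactorCount (b ∷ c ∷ a ∷ [])        ≤⟨ palFactorCount≤ (b ∷ c ∷ a ∷ []) ⟩
    4                                      ∎)
    where open ≤-Reasoning

𝟙 : Bool → ℕ
𝟙 true  = 1
𝟙 false = 0

𝟙-∧ : ∀ x y → 𝟙 (x ∧ y) ≡ 𝟙 x * 𝟙 y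
𝟙-∧ true  y = sym (+-identityʳ (𝟙 y))
𝟙-∧ false y = refl

𝟙-not : ∀ x → 𝟙 (not x) + 𝟙 x ≡ 1
𝟙-not true  = refl
𝟙-not false = refl

count : ∀ {A : Set} → (A → Bool) → List A → ℕ
count p []       = 0
count p (x ∷ xs) = 𝟙 (p x) + count p xs

module _ {A : Set} where

  private variable
    p q : A → Bool

  count-++ : ∀ p (xs ys : List A) → count p (xs ++ ys) ≡ count p xs + count p ys
  count-++ p []       ys = refl
  count-++ p (x ∷ xs) ys = trans (cong (𝟙 (p x) +_) (count-++ p xs ys)) (sym (+-assoc (𝟙 (p x)) _ _))

  count-map : ∀ {B : Set} p (f : B → A) xs → count p (map f xs) ≡ count (λ x → p (f x)) xs
  count-map p f []       = refl
  count-map p f (x ∷ xs) = cong (𝟙 (p (f x)) +_) (count-map p f xs)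

  count-concatMap-tabulate : ∀ {B : Set} {n} p (f : B → List A) (g : Fin n → B) →
    count p (concatMap f (tabulate g)) ≡ ∑[ i < n ] count p (f (g i))
  count-concatMap-tabulate {n = zero}  p f g = refl
  count-concatMap-tabulate {n = suc n} p f g = trans (count-++ p (f (g Fin.zero)) _)
    (cong (count p (f (g Fin.zero)) +_) (count-concatMap-tabulate p f (λ i → g (Fin.suc i))))

  count-cong : (∀ x → p x ≡ q x) → ∀ (xs : List A) → count p xs ≡ count q xs
  count-cong p≗q []       = refl
  count-cong p≗q (x ∷ xs) = cong₂ _+_ (cong 𝟙 (p≗q x)) (count-cong p≗q xs)

  count-∧ˡ : ∀ b q (xs : List A) → count (λ x → b ∧ q x) xs ≡ 𝟙 b * count q xs
  count-∧ˡ true  q xs       = sym (+-identityʳ (count q xs))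
  count-∧ˡ false q []       = refl
  count-∧ˡ false q (x ∷ xs) = count-∧ˡ false q xs

  count-true : ∀ (xs : List A) → count (λ _ → true) xs ≡ length xs
  count-true []       = refl
  count-true (x ∷ xs) = cong suc (count-true xs)

  count≤length : ∀ p (xs : List A) → count p xs ≤ length xs
  count≤length p []       = z≤n
  count≤length p (x ∷ xs) with p x
  ... | true  = s≤s (count≤length p xs)
  ... | false = m≤n⇒m≤1+n (count≤length p xs)

  count-not+count : ∀ p (xs : List A) → count (λ x → not (p x)) xs + count p xs ≡ length xs
  count-not+count p []       = refl
  count-not+count p (x ∷ xs) = begin
    (𝟙 (not (p x)) + count (λ x → not (p x)) xs) + (𝟙 (p x) + count p xs)
      ≡⟨ +-interchange (𝟙 (not (p x))) _ (𝟙 (p x)) _ ⟩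
    (𝟙 (not (p x)) + 𝟙 (p x)) + (count (λ x → not (p x)) xs + count p xs)
      ≡⟨ cong₂ _+_ (𝟙-not (p x)) (count-not+count p xs) ⟩
    suc (length xs) ∎
    where open ≡-Reasoning

  length-filter≤count : ∀ {P : A → Set} (P? : Decidable P) p → (∀ {x} → P x → p x ≡ true) →
                        ∀ xs → length (filter P? xs) ≤ count p xs
  length-filter≤count P? p P⇒p [] = z≤n
  length-filter≤count P? p P⇒p (x ∷ xs) with P? x
  ... | yes Px rewrite P⇒p Px = s≤s (length-filter≤count P? p P⇒p xs)
  ... | no _   = ≤-trans (length-filter≤count P? p P⇒p xs) (m≤n+m _ (𝟙 (p x)))

∑-const : ∀ n c → ∑[ i < n ] c ≡ n * c
∑-const zero    c = refl
∑-const (suc n) c = cong (c +_) (∑-const n c)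

∑-complement : ∀ {n m} (f g : Fin n → ℕ) → (∀ i → f i + g i ≡ 1) → ∑[ i < n ] g i ≡ m → ∑[ i < n ] f i ≡ n ∸ m
∑-complement {n} {m} f g f+g≡1 ∑g≡m = begin
  ∑[ i < n ] f i                      ≡⟨ m+n∸n≡m (∑[ i < n ] f i) m ⟨
  ∑[ i < n ] f i + m ∸ m              ≡⟨ cong (λ t → ∑[ i < n ] f i + t ∸ m) ∑g≡m ⟨
  ∑[ i < n ] f i + ∑[ i < n ] g i ∸ m ≡⟨ cong (_∸ m) (∑-distrib-+ f g) ⟨
  ∑[ i < n ] (f i + g i) ∸ m          ≡⟨ cong (_∸ m) (trans (sum-cong-≗ f+g≡1) (trans (∑-const n 1) (*-identityʳ n))) ⟩
  n ∸ m                               ∎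
  where open ≡-Reasoning

_≡ᵇ_ : ∀ {n} → Fin n → Fin n → Bool
a ≡ᵇ b = does (a ≟ b)

∑-≡ᵇ : ∀ {n} (a : Fin n) → ∑[ x < n ] 𝟙 (a ≡ᵇ x) ≡ 1
∑-≡ᵇ {suc n} Fin.zero    = cong suc (trans (∑-const n 0) (*-zeroʳ n))
∑-≡ᵇ {suc n} (Fin.suc a) = ∑-≡ᵇ a

∑-≢ᵇ : ∀ {n} (a : Fin n) → ∑[ x < n ] 𝟙 (not (a ≡ᵇ x)) ≡ n ∸ 1
∑-≢ᵇ a = ∑-complement _ _ (λ x → 𝟙-not (a ≡ᵇ x)) (∑-≡ᵇ a)

∑-≢ᵇ₂ : ∀ {n} {a b : Fin n} → a ≢ b → ∑[ x < n ] 𝟙 (not (b ≡ᵇ x) ∧ not (a ≡ᵇ x)) ≡ n ∸ 2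
∑-≢ᵇ₂ {n} {a} {b} a≢b = ∑-complement _ (λ x → 𝟙 (b ≡ᵇ x) + 𝟙 (a ≡ᵇ x)) partition
  (trans (∑-distrib-+ (λ x → 𝟙 (b ≡ᵇ x)) (λ x → 𝟙 (a ≡ᵇ x))) (cong₂ _+_ (∑-≡ᵇ b) (∑-≡ᵇ a)))
  where
  partition : ∀ x → 𝟙 (not (b ≡ᵇ x) ∧ not (a ≡ᵇ x)) + (𝟙 (b ≡ᵇ x) + 𝟙 (a ≡ᵇ x)) ≡ 1
  partition x with b ≟ x | a ≟ x
  ... | yes refl | yes refl = ⊥-elim (a≢b refl)
  ... | yes _    | no _     = refl
  ... | no _     | yes _    = refl
  ... | no _     | no _     = refl

module _ {k : ℕ} where

  distinctᵇ : Fin k → Fin k → Fin k → Bool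
  distinctᵇ a b c = not (a ≡ᵇ b) ∧ not (b ≡ᵇ c) ∧ not (a ≡ᵇ c)

  isABCA : Fin k → Fin k → Fin k → Fin k → Bool
  isABCA a b c d = (a ≡ᵇ d) ∧ distinctᵇ a b c

  blocksOK : Word k → Bool
  blocksOK (a ∷ b ∷ c ∷ d ∷ w) = not (isABCA a b c d) ∧ blocksOK w
  blocksOK _                   = true

  rich⇒¬isABCA : ∀ a b c d → Rich (a ∷ b ∷ c ∷ d ∷ []) → isABCA a b c d ≡ false
  rich⇒¬isABCA a b c d rich with a ≟ d | a ≟ b | b ≟ c | a ≟ c
  ... | no _     | _      | _      | _      = refl
  ... | yes _    | yes _  | _      | _      = refl
  ... | yes _    | no _   | yes _  | _      = refl
  ... | yes _    | no _   | no _   | yes _  = refl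
  ... | yes refl | no a≢b | no b≢c | no a≢c = ⊥-elim (abca-¬rich a≢b b≢c a≢c rich)

  rich⇒blocksOK : ∀ w → Rich w → blocksOK w ≡ true
  rich⇒blocksOK (a ∷ b ∷ c ∷ d ∷ w) rich = cong₂ _∧_
    (cong not (rich⇒¬isABCA a b c d (rich-prefix (a ∷ b ∷ c ∷ d ∷ []) w rich)))
    (rich⇒blocksOK w (rich-suffix (a ∷ b ∷ c ∷ d ∷ []) w rich))
  rich⇒blocksOK []                  _ = refl
  rich⇒blocksOK (_ ∷ [])            _ = refl
  rich⇒blocksOK (_ ∷ _ ∷ [])        _ = refl
  rich⇒blocksOK (_ ∷ _ ∷ _ ∷ [])    _ = refl

  count-allWords-suc : ∀ p n → count p (allWords k (suc n)) ≡ ∑[ a < k ] count (λ w → p (a ∷ w)) (allWords k n)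
  count-allWords-suc p n = trans (count-concatMap-tabulate p (λ a → map (a ∷_) (allWords k n)) id)
                                 (sum-cong-≗ λ a → count-map p (a ∷_) (allWords k n))

  length-allWords : ∀ n → length (allWords k n) ≡ k ^ n
  length-allWords zero    = refl
  length-allWords (suc n) = begin
    length (allWords k (suc n))                        ≡⟨ count-true (allWords k (suc n)) ⟨
    count (λ _ → true) (allWords k (suc n))            ≡⟨ count-allWords-suc (λ _ → true) n ⟩
    ∑[ a < k ] count (λ _ → true) (allWords k n)       ≡⟨ ∑-const k _ ⟩
    k * count (λ _ → true) (allWords k n)              ≡⟨ cong (k *_) (trans (count-true (allWords k n)) (length-allWords n)) ⟩
    k * k ^ n                                          ∎
    where open ≡-Reasoning

  count-allWords-split : ∀ m n (p q : Word k → Bool) →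
    count (λ w → p (take m w) ∧ q (drop m w)) (allWords k (m + n)) ≡ count p (allWords k m) * count q (allWords k n)
  count-allWords-split zero    n p q = trans (count-∧ˡ (p []) q (allWords k n)) (cong (_* _) (sym (+-identityʳ (𝟙 (p [])))))
  count-allWords-split (suc m) n p q = begin
    count (λ w → p (take (suc m) w) ∧ q (drop (suc m) w)) (allWords k (suc m + n))
      ≡⟨ count-allWords-suc _ (m + n) ⟩
    ∑[ a < k ] count (λ w → p (a ∷ take m w) ∧ q (drop m w)) (allWords k (m + n))
      ≡⟨ sum-cong-≗ (λ a → count-allWords-split m n (λ w → p (a ∷ w)) q) ⟩
    ∑[ a < k ] (count (λ w → p (a ∷ w)) (allWords k m) * count q (allWords k n))
      ≡⟨ *-distribʳ-sum (count q (allWords k n)) (λ a → count (λ w → p (a ∷ w)) (allWords k m)) ⟨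
    (∑[ a < k ] count (λ w → p (a ∷ w)) (allWords k m)) * count q (allWords k n)
      ≡⟨ cong (_* count q (allWords k n)) (count-allWords-suc p m) ⟨
    count p (allWords k (suc m)) * count q (allWords k n)
      ∎
    where open ≡-Reasoning

  count-allWords-4 : ∀ p → count p (allWords k 4) ≡
    ∑[ a < k ] ∑[ b < k ] ∑[ c < k ] ∑[ d < k ] 𝟙 (p (a ∷ b ∷ c ∷ d ∷ []))
  count-allWords-4 p = begin
    count p (allWords k 4)
      ≡⟨ count-allWords-suc p 3 ⟩
    ∑[ a < k ] count (λ w → p (a ∷ w)) (allWords k 3)
      ≡⟨ (sum-cong-≗ λ a → count-allWords-suc (λ w → p (a ∷ w)) 2) ⟩
    ∑[ a < k ] ∑[ b < k ] count (λ w → p (a ∷ b ∷ w)) (allWords k 2)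
      ≡⟨ (sum-cong-≗ λ a → sum-cong-≗ λ b → count-allWords-suc (λ w → p (a ∷ b ∷ w)) 1) ⟩
    ∑[ a < k ] ∑[ b < k ] ∑[ c < k ] count (λ w → p (a ∷ b ∷ c ∷ w)) (allWords k 1)
      ≡⟨ (sum-cong-≗ λ a → sum-cong-≗ λ b → sum-cong-≗ λ c →
           trans (count-allWords-suc (λ w → p (a ∷ b ∷ c ∷ w)) 0) (sum-cong-≗ λ d → +-identityʳ (𝟙 (p (a ∷ b ∷ c ∷ d ∷ []))))) ⟩
    ∑[ a < k ] ∑[ b < k ] ∑[ c < k ] ∑[ d < k ] 𝟙 (p (a ∷ b ∷ c ∷ d ∷ []))
      ∎
    where open ≡-Reasoning

  blocksOK-split : ∀ w → blocksOK w ≡ blocksOK (take 4 w) ∧ blocksOK (drop 4 w)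
  blocksOK-split (a ∷ b ∷ c ∷ d ∷ w) = cong (_∧ blocksOK w) (sym (∧-identityʳ _))
  blocksOK-split []                  = refl
  blocksOK-split (_ ∷ [])            = refl
  blocksOK-split (_ ∷ _ ∷ [])        = refl
  blocksOK-split (_ ∷ _ ∷ _ ∷ [])    = refl

  blocksOK-count-+4 : ∀ n → count blocksOK (allWords k (4 + n)) ≡ count blocksOK (allWords k 4) * count blocksOK (allWords k n)
  blocksOK-count-+4 n = trans (count-cong blocksOK-split (allWords k (4 + n))) (count-allWords-split 4 n blocksOK blocksOK)

  ∑-isABCA : ∀ a b c → ∑[ d < k ] 𝟙 (isABCA a b c d) ≡ 𝟙 (distinctᵇ a b c)
  ∑-isABCA a b c = begin
    ∑[ d < k ] 𝟙 (isABCA a b c d)                   ≡⟨ sum-cong-≗ (λ d → 𝟙-∧ (a ≡ᵇ d) (distinctᵇ a b c)) ⟩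
    ∑[ d < k ] (𝟙 (a ≡ᵇ d) * 𝟙 (distinctᵇ a b c))   ≡⟨ *-distribʳ-sum (𝟙 (distinctᵇ a b c)) (λ d → 𝟙 (a ≡ᵇ d)) ⟨
    (∑[ d < k ] 𝟙 (a ≡ᵇ d)) * 𝟙 (distinctᵇ a b c)   ≡⟨ cong (_* 𝟙 (distinctᵇ a b c)) (∑-≡ᵇ a) ⟩
    1 * 𝟙 (distinctᵇ a b c)                         ≡⟨ *-identityˡ _ ⟩
    𝟙 (distinctᵇ a b c)                             ∎
    where open ≡-Reasoning

  ∑-distinctᵇ : ∀ a b → ∑[ c < k ] 𝟙 (distinctᵇ a b c) ≡ 𝟙 (not (a ≡ᵇ b)) * (k ∸ 2)
  ∑-distinctᵇ a b with a ≟ b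
  ... | yes _   = trans (∑-const k 0) (*-zeroʳ k)
  ... | no a≢b = trans (∑-≢ᵇ₂ a≢b) (sym (*-identityˡ (k ∸ 2)))

  badBlockCount : count (λ w → not (blocksOK w)) (allWords k 4) ≡ k * (k ∸ 1) * (k ∸ 2)
  badBlockCount = begin
    count (λ w → not (blocksOK w)) (allWords k 4)
      ≡⟨ count-allWords-4 (λ w → not (blocksOK w)) ⟩
    ∑[ a < k ] ∑[ b < k ] ∑[ c < k ] ∑[ d < k ] 𝟙 (not (not (isABCA a b c d) ∧ true))
      ≡⟨ (sum-cong-≗ λ a → sum-cong-≗ λ b → sum-cong-≗ λ c → sum-cong-≗ λ d →
           cong 𝟙 (trans (cong not (∧-identityʳ (not (isABCA a b c d)))) (not-involutive (isABCA a b c d)))) ⟩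
    ∑[ a < k ] ∑[ b < k ] ∑[ c < k ] ∑[ d < k ] 𝟙 (isABCA a b c d)
      ≡⟨ (sum-cong-≗ λ a → sum-cong-≗ λ b → sum-cong-≗ λ c → ∑-isABCA a b c) ⟩
    ∑[ a < k ] ∑[ b < k ] ∑[ c < k ] 𝟙 (distinctᵇ a b c)
      ≡⟨ (sum-cong-≗ λ a → sum-cong-≗ λ b → ∑-distinctᵇ a b) ⟩
    ∑[ a < k ] ∑[ b < k ] (𝟙 (not (a ≡ᵇ b)) * (k ∸ 2))
      ≡⟨ sum-cong-≗ ∑-≢ᵇ*[k∸2] ⟩
    ∑[ a < k ] ((k ∸ 1) * (k ∸ 2))
      ≡⟨ ∑-const k _ ⟩
    k * ((k ∸ 1) * (k ∸ 2))
      ≡⟨ *-assoc k (k ∸ 1) (k ∸ 2) ⟨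
    k * (k ∸ 1) * (k ∸ 2)
      ∎
    where
    open ≡-Reasoning
    ∑-≢ᵇ*[k∸2] : ∀ a → ∑[ b < k ] (𝟙 (not (a ≡ᵇ b)) * (k ∸ 2)) ≡ (k ∸ 1) * (k ∸ 2)
    ∑-≢ᵇ*[k∸2] a = trans (sym (*-distribʳ-sum (k ∸ 2) (λ b → 𝟙 (not (a ≡ᵇ b))))) (cong (_* (k ∸ 2)) (∑-≢ᵇ a))

  goodBlockCount : count blocksOK (allWords k 4) ≡ k ^ 4 ∸ k * (k ∸ 1) * (k ∸ 2)
  goodBlockCount = begin
    count blocksOK (allWords k 4)                         ≡⟨ m+n∸m≡n bad _ ⟨
    bad + count blocksOK (allWords k 4) ∸ bad             ≡⟨ cong (_∸ bad) (count-not+count blocksOK (allWords k 4)) ⟩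
    length (allWords k 4) ∸ bad                           ≡⟨ cong₂ _∸_ (length-allWords 4) badBlockCount ⟩
    k ^ 4 ∸ k * (k ∸ 1) * (k ∸ 2)                         ∎
    where
    open ≡-Reasoning
    bad = count (λ w → not (blocksOK w)) (allWords k 4)

aligned-bound : ∀ {k G} (f : ℕ → ℕ) → (∀ n → f n ≤ k ^ n) → (∀ n → f (4 + n) ≡ G * f n) →
                ∀ n → f n * (k ^ 4) ^ (n / 4) ≤ G ^ (n / 4) * k ^ n
aligned-bound f f≤ _ 0 = subst₂ _≤_ (sym (*-identityʳ (f 0))) (sym (*-identityˡ _)) (f≤ 0)
aligned-bound f f≤ _ 1 = subst₂ _≤_ (sym (*-identityʳ (f 1))) (sym (*-identityˡ _)) (f≤ 1)
aligned-bound f f≤ _ 2 = subst₂ _≤_ (sym (*-identityʳ (f 2))) (sym (*-identityˡ _)) (f≤ 2)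
aligned-bound f f≤ _ 3 = subst₂ _≤_ (sym (*-identityʳ (f 3))) (sym (*-identityˡ _)) (f≤ 3)
aligned-bound {k} {G} f f≤ f+4 n@(suc (suc (suc (suc m))))
  rewrite m/n≡1+[m∸n]/n {n} {4} (s≤s (s≤s (s≤s (s≤s z≤n)))) = begin
    f (4 + m) * (k ^ 4 * (k ^ 4) ^ q)     ≡⟨ cong (_* (k ^ 4 * (k ^ 4) ^ q)) (f+4 m) ⟩
    G * f m * (k ^ 4 * (k ^ 4) ^ q)       ≡⟨ *-interchange G (f m) (k ^ 4) ((k ^ 4) ^ q) ⟩
    G * k ^ 4 * (f m * (k ^ 4) ^ q)       ≤⟨ *-monoʳ-≤ (G * k ^ 4) (aligned-bound f f≤ f+4 m) ⟩
    G * k ^ 4 * (G ^ q * k ^ m)           ≡⟨ *-interchange G (k ^ 4) (G ^ q) (k ^ m) ⟩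
    G * G ^ q * (k ^ 4 * k ^ m)           ≡⟨ cong (G * G ^ q *_) (^-distribˡ-+-* k 4 m) ⟨
    G * G ^ q * k ^ (4 + m)               ∎
  where
  open ≤-Reasoning
  q = m / 4

mainTheorem16 : (k : ℕ) → 3 ≤ k → (n : ℕ) →
    r k n * (k ^ 4) ^ (n / 4) ≤ (k ^ 4 ∸ k * (k ∸ 1) * (k ∸ 2)) ^ (n / 4) * k ^ n
mainTheorem16 k _ n = begin
  r k n * (k ^ 4) ^ (n / 4)                 ≤⟨ *-monoˡ-≤ _ (length-filter≤count rich? blocksOK (λ {w} → rich⇒blocksOK w) (allWords k n)) ⟩
  admissible n * (k ^ 4) ^ (n / 4)          ≤⟨ aligned-bound admissible admissible≤ admissible-+4 n ⟩
  (k ^ 4 ∸ k * (k ∸ 1) * (k ∸ 2)) ^ (n / 4) * k ^ n ∎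
  where
  open ≤-Reasoning
  admissible : ℕ → ℕ
  admissible m = count blocksOK (allWords k m)
  admissible≤ : ∀ m → admissible m ≤ k ^ m
  admissible≤ m = subst (admissible m ≤_) (length-allWords m) (count≤length blocksOK (allWords k m))
  admissible-+4 : ∀ m → admissible (4 + m) ≡ (k ^ 4 ∸ k * (k ∸ 1) * (k ∸ 2)) * admissible m
  admissible-+4 m = trans (blocksOK-count-+4 {k} m) (cong (_* admissible m) (goodBlockCount {k}))
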